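{- Let $Z$ be a non-degenerate multimatroid. Suppose that $B$ is a basis of $Z$ and $\omega$ is a skew class such that the fundamental circuit $C(B,\omega)$ exists. Then an element $f$ of $B-\omega$ is in $C(B,\omega)$ if and only if the skew class containing $f$ has an element $x$ such that $B\triangle\{B_{\omega}, \underline B_{\omega}, f, x\}$ is a basis of $Z$.
   Context: A carrier is a pair $(U,\Omega)$, $U$ finite, $\Omega$ a partition of $U$ into non-empty skew classes; subtransversals meet each skew class at most once, transversals exactly once; skew pair: two distinct elements of a skew class. A multimatroid $Z=(U,\Omega,r)$ has a non-negative integer $r$ on subtransversals with (R1) on each transversal $r$ is a matroid rank function; (R2) for subtransversal $S$ and skew pair $\{x,y\}$ in a skew class disjoint from $S$, $r(S\cup\{x\})+r(S\cup\{y\})-2r(S)\ge1$. Bases are maximal subtransversals $S$ with $r(S)=|S|$; circuits are minimal subtransversals with $r(S)<|S|$. Non-degenerate: all skew classes have size at least 2 (then bases are transversals). $B_\omega$ is the element of $B\cap\omega$. For a basis $B$ and skew class $\omega$, $B\cup\omega$ contains at most one circuit; if it exists it is the fundamental circuit $C(B,\omega)$, and $\underline B_\omega$ is the unique element of $C(B,\omega)-B$. $\triangle$ denotes symmetric difference. -}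

module Defs where

open import Data.Nat using (ℕ; _+_; _*_; _≤_; _<_)
open import Data.Fin using (Fin)
open import Data.Fin.Subset using (Subset; _∈_; _∉_; _⊆_; _∪_; _∩_; ∣_∣; ⁅_⁆; ⊥)
open import Data.Vec using (zipWith)
open import Data.Bool using (_xor_)
open import Data.Product using (Σ; _×_; ∃; ∃-syntax)
open import Data.Sum using (_⊎_)
open import Relation.Nullary using (¬_)
open import Relation.Binary.PropositionalEquality using (_≡_; _≢_)

-- Ground set U = Fin n; skew classes are indexed by Fin m, and
-- cls : Fin n → Fin m sends an element to its skew class.

module _ {n m : ℕ} (cls : Fin n → Fin m) where

  IsSubtransversal : Subset n → Set
  IsSubtransversal S = ∀ {x y} → x ∈ S → y ∈ S → cls x ≡ cls y → x ≡ y

  IsTransversal : Subset n → Set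
  IsTransversal S = IsSubtransversal S × (∀ ω → ∃[ x ] (x ∈ S × cls x ≡ ω))

  DisjointFromClass : Subset n → Fin m → Set
  DisjointFromClass S ω = ∀ {x} → x ∈ S → cls x ≢ ω

record IsMatroidRankOn {n : ℕ} (r : Subset n → ℕ) (T : Subset n) : Set where
  field
    bounded   : ∀ X → X ⊆ T → r X ≤ ∣ X ∣
    monotone  : ∀ X Y → Y ⊆ T → X ⊆ Y → r X ≤ r Y
    submod    : ∀ X Y → X ⊆ T → Y ⊆ T → r (X ∪ Y) + r (X ∩ Y) ≤ r X + r Y

-- A multimatroid on carrier (Fin n, classes given by cls).
-- r is a function on all subsets, but only its values on subtransversals matter.
record Multimatroid (n m : ℕ) : Set where
  field
    cls      : Fin n → Fin m
    nonempty : ∀ (ω : Fin m) → ∃[ x ] cls x ≡ ω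
    r        : Subset n → ℕ
    R1       : ∀ T → IsTransversal cls T → IsMatroidRankOn r T
    R2       : ∀ S x y → IsSubtransversal cls S → x ≢ y → cls x ≡ cls y →
               DisjointFromClass cls S (cls x) →
               1 + 2 * r S ≤ r (S ∪ ⁅ x ⁆) + r (S ∪ ⁅ y ⁆)

module _ {n m : ℕ} (Z : Multimatroid n m) where
  open Multimatroid Z

  NonDegenerate : Set
  NonDegenerate = ∀ (ω : Fin m) → ∃[ x ] ∃[ y ] (x ≢ y × cls x ≡ ω × cls y ≡ ω)

  IsIndependent : Subset n → Set
  IsIndependent S = IsSubtransversal cls S × r S ≡ ∣ S ∣

  IsBasis : Subset n → Set
  IsBasis B = IsIndependent B × (∀ S → B ⊆ S → IsIndependent S → S ≡ B)

  IsCircuit : Subset n → Set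
  IsCircuit C = IsSubtransversal cls C × r C < ∣ C ∣ ×
                (∀ D → D ⊆ C → r D < ∣ D ∣ → D ≡ C)

  -- C is a circuit contained in B ∪ ω; for a basis B this circuit is unique
  -- when it exists, i.e. C is the fundamental circuit C(B, ω).
  IsFundamentalCircuit : Subset n → Fin m → Subset n → Set
  IsFundamentalCircuit B ω C = IsCircuit C × (∀ x → x ∈ C → x ∈ B ⊎ cls x ≡ ω)

infixl 6 _△_
_△_ : ∀ {n} → Subset n → Subset n → Subset n
_△_ = zipWith _xor_

⁅_,_,_,_⁆ : ∀ {n} → Fin n → Fin n → Fin n → Fin n → Subset n
⁅ a , b , c , d ⁆ = ⁅ a ⁆ ∪ ⁅ b ⁆ ∪ ⁅ c ⁆ ∪ ⁅ d ⁆

{-# OPTIONS --safe #-}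
-- Let T = (B - B_ω) ∪ {B̲_ω}. It is a transversal containing C, of nullity at most one because B - B_ω is
-- independent, and B △ {B_ω, B̲_ω, f, x} = T △ {f, x}. If f ∈ C, then f is spanned by C - f, so deleting f
-- from T keeps the rank and T - f is independent; since adding f to T - f does not raise the rank, (R2)
-- forces adding the skew partner x to raise it, and T - f + x is an independent transversal, i.e. a basis.
-- If f ∉ C, then for x ≠ f the transversal T - f + x still contains the dependent set C, and for x = f the
-- set T - f misses the skew class of f, so neither is a basis.
module Submission where

open import Defs
open import Level using (0ℓ)
open import Data.Nat using (ℕ; suc; _+_; _*_; _≤_; _<_; s≤s; s≤s⁻¹)
open import Data.Nat.Properties
  using (≤-trans; ≤-antisym; ≮⇒≥; <⇒≱; <⇒≢; ≤∧≢⇒<; m≤m+n; +-suc; +-comm; +-assoc;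
         +-identityʳ; +-mono-≤; +-monoˡ-≤; +-monoʳ-≤; +-cancelˡ-≤; +-cancelʳ-≤; module ≤-Reasoning)
open import Data.Bool using (true; false; _∨_; _xor_)
open import Data.Bool.Properties using (xor-identityʳ; ∨-identityʳ)
open import Data.Fin using (Fin; zero; suc; _≟_)
open import Data.Fin.Properties using (any?)
open import Data.Fin.Subset
  using (Subset; inside; outside; _∈_; _∉_; _⊆_; _∪_; _∩_; _─_; _-_; ∣_∣; ⁅_⁆; ⊥)
open import Data.Fin.Subset.Properties
  using (_∈?_; ⊆-refl; ⊆-antisym; p⊆p∪q; x∈⁅x⁆; x∈⁅y⁆⇒x≡y; x≢y⇒x∉⁅y⁆; x∈p∪q⁺; x∈p∪q⁻; x∈p∩q⁺; p∩q⊆q; p─q⊆p;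
         x∈p∧x∉q⇒x∈p─q; x∈p∧x≢y⇒x∈p-y; p─⊥≡p; ∪-identityʳ; ∪-assoc; ∪-idem;
         drop-not-there; drop-∷-⊆)
open import Data.Vec using (_∷_; []; here; there; tabulate)
open import Data.Vec.Properties using (zipWith-identityʳ; lookup∘tabulate; lookup⇒[]=; []=⇒lookup)
-- `_,_` is only opened locally: at top level it makes `⁅ b , u , f , x ⁆` ambiguous.
open import Data.Product using (_×_; proj₁; proj₂; ∃-syntax)
open import Data.Sum using (_⊎_; inj₁; inj₂; [_,_]′)
open import Data.Empty using (⊥-elim)
open import Function using (id; _∘_; _∘′_)
open import Function.Bundles using (_⇔_; mk⇔; module Equivalence)
open import Relation.Nullary using (¬_; Dec; yes; no; does; contradiction; ¬?; _×-dec_; _⊎-dec_)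
open import Relation.Nullary.Decidable using (dec-true)
open import Relation.Unary using (Pred; Decidable)
open import Relation.Binary.PropositionalEquality
  using (_≡_; _≢_; refl; sym; trans; cong; cong₂; subst; module ≡-Reasoning)

private
  variable
    n : ℕ
    p q s : Subset n
    x y : Fin n

x∉p-x : ∀ (p : Subset n) x → x ∉ p - x
x∉p-x (_ ∷ _) zero    ()
x∉p-x (_ ∷ p) (suc x) (there x∈p-x) = x∉p-x p x x∈p-x

x∈p-y⇒x≢y : x ∈ p - y → x ≢ y
x∈p-y⇒x≢y {x = x} {p = p} x∈p-y refl = x∉p-x p x x∈p-y

x∈p∪⁅y⁆⁻ : x ∈ p ∪ ⁅ y ⁆ → x ∈ p ⊎ x ≡ y
x∈p∪⁅y⁆⁻ {p = p} {y = y} x∈ = [ inj₁ , inj₂ ∘′ x∈⁅y⁆⇒x≡y y ]′ (x∈p∪q⁻ p ⁅ y ⁆ x∈)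

p⊆s∧q⊆s⇒p∪q⊆s : p ⊆ s → q ⊆ s → p ∪ q ⊆ s
p⊆s∧q⊆s⇒p∪q⊆s {p = p} {s = s} {q = q} p⊆s q⊆s x∈ = [ p⊆s , q⊆s ]′ (x∈p∪q⁻ p q x∈)

x∈p⇒⁅x⁆⊆p : x ∈ p → ⁅ x ⁆ ⊆ p
x∈p⇒⁅x⁆⊆p {x = x} x∈p y∈⁅x⁆ with refl ← x∈⁅y⁆⇒x≡y x y∈⁅x⁆ = x∈p

x∉p∧x∉q⇒x∉p∪q : x ∉ p → x ∉ q → x ∉ p ∪ q
x∉p∧x∉q⇒x∉p∪q {p = p} {q = q} x∉p x∉q x∈ = [ x∉p , x∉q ]′ (x∈p∪q⁻ p q x∈)

x∈p⇒suc∣p-x∣≡∣p∣ : x ∈ p → suc ∣ p - x ∣ ≡ ∣ p ∣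
x∈p⇒suc∣p-x∣≡∣p∣ {p = _ ∷ p}       here          = cong (suc ∘ ∣_∣) (p─⊥≡p p)
x∈p⇒suc∣p-x∣≡∣p∣ {p = inside ∷ _}  (there x∈p)   = cong suc (x∈p⇒suc∣p-x∣≡∣p∣ x∈p)
x∈p⇒suc∣p-x∣≡∣p∣ {p = outside ∷ _} (there x∈p)   = x∈p⇒suc∣p-x∣≡∣p∣ x∈p

x∉p⇒∣p∪⁅x⁆∣≡suc∣p∣ : x ∉ p → ∣ p ∪ ⁅ x ⁆ ∣ ≡ suc ∣ p ∣
x∉p⇒∣p∪⁅x⁆∣≡suc∣p∣ {x = zero}  {p = outside ∷ p} _   = cong (suc ∘ ∣_∣) (∪-identityʳ p)
x∉p⇒∣p∪⁅x⁆∣≡suc∣p∣ {x = zero}  {p = inside ∷ _}  x∉p = contradiction here x∉p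
x∉p⇒∣p∪⁅x⁆∣≡suc∣p∣ {x = suc _} {p = outside ∷ _} x∉p = x∉p⇒∣p∪⁅x⁆∣≡suc∣p∣ (drop-not-there x∉p)
x∉p⇒∣p∪⁅x⁆∣≡suc∣p∣ {x = suc _} {p = inside ∷ _}  x∉p = cong suc (x∉p⇒∣p∪⁅x⁆∣≡suc∣p∣ (drop-not-there x∉p))

p⊆q⇒∣q∣≡∣p∣+∣q─p∣ : p ⊆ q → ∣ q ∣ ≡ ∣ p ∣ + ∣ q ─ p ∣
p⊆q⇒∣q∣≡∣p∣+∣q─p∣ {p = []}          {q = []}          _   = refl
p⊆q⇒∣q∣≡∣p∣+∣q─p∣ {p = inside ∷ _}  {q = inside ∷ _}  p⊆q = cong suc (p⊆q⇒∣q∣≡∣p∣+∣q─p∣ (drop-∷-⊆ p⊆q))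
p⊆q⇒∣q∣≡∣p∣+∣q─p∣ {p = inside ∷ _}  {q = outside ∷ _} p⊆q with () ← p⊆q here
p⊆q⇒∣q∣≡∣p∣+∣q─p∣ {p = outside ∷ p} {q = inside ∷ q}  p⊆q =
  trans (cong suc (p⊆q⇒∣q∣≡∣p∣+∣q─p∣ (drop-∷-⊆ p⊆q))) (sym (+-suc ∣ p ∣ ∣ q ─ p ∣))
p⊆q⇒∣q∣≡∣p∣+∣q─p∣ {p = outside ∷ _} {q = outside ∷ _} p⊆q = p⊆q⇒∣q∣≡∣p∣+∣q─p∣ (drop-∷-⊆ p⊆q)

∈-tabulate-does⁺ : ∀ {P : Pred (Fin n) 0ℓ} (P? : Decidable P) → P x → x ∈ tabulate (does ∘ P?)
∈-tabulate-does⁺ {x = x} P? Px = lookup⇒[]= x _ (trans (lookup∘tabulate (does ∘ P?) x) (dec-true (P? x) Px))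

∈-tabulate-does⁻ : ∀ {P : Pred (Fin n) 0ℓ} (P? : Decidable P) → x ∈ tabulate (does ∘ P?) → P x
∈-tabulate-does⁻ {x = x} P? x∈ with P? x | trans (sym (lookup∘tabulate (does ∘ P?) x)) ([]=⇒lookup x∈)
... | yes Px | _  = Px
... | no  _  | ()

p△⊥≡p : ∀ (p : Subset n) → p △ ⊥ ≡ p
p△⊥≡p = zipWith-identityʳ xor-identityʳ

x∈p⇒p△⁅x⁆≡p-x : x ∈ p → p △ ⁅ x ⁆ ≡ p - x
x∈p⇒p△⁅x⁆≡p-x {p = _ ∷ p}   here        = cong (outside ∷_) (trans (p△⊥≡p p) (sym (p─⊥≡p p)))
x∈p⇒p△⁅x⁆≡p-x {p = b ∷ _}   (there x∈p) = cong₂ _∷_ (xor-identityʳ b) (x∈p⇒p△⁅x⁆≡p-x x∈p)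

x∉p⇒p△⁅x⁆≡p∪⁅x⁆ : x ∉ p → p △ ⁅ x ⁆ ≡ p ∪ ⁅ x ⁆
x∉p⇒p△⁅x⁆≡p∪⁅x⁆ {x = zero}  {p = outside ∷ p} _   = cong (inside ∷_) (trans (p△⊥≡p p) (sym (∪-identityʳ p)))
x∉p⇒p△⁅x⁆≡p∪⁅x⁆ {x = zero}  {p = inside ∷ _}  x∉p = contradiction here x∉p
x∉p⇒p△⁅x⁆≡p∪⁅x⁆ {x = suc _} {p = b ∷ _}      x∉p =
  cong₂ _∷_ (trans (xor-identityʳ b) (sym (∨-identityʳ b))) (x∉p⇒p△⁅x⁆≡p∪⁅x⁆ (drop-not-there x∉p))

p△[q∪s]≡p△q△s : (∀ {x} → x ∈ q → x ∉ s) → p △ (q ∪ s) ≡ p △ q △ s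
p△[q∪s]≡p△q△s {q = []}     {s = []}     {p = []}    _        = refl
p△[q∪s]≡p△q△s {q = c ∷ q}  {s = d ∷ s}  {p = b ∷ p} disjoint =
  cong₂ _∷_ (head c d disjoint) (p△[q∪s]≡p△q△s (λ x∈q x∈s → disjoint (there x∈q) (there x∈s)))
  where
  head : ∀ c d → (∀ {x} → x ∈ c ∷ q → x ∉ d ∷ s) → b xor (c ∨ d) ≡ (b xor c) xor d
  head true  true  disjoint = contradiction here (disjoint here)
  head true  false _        = sym (xor-identityʳ _)
  head false d     _        = cong (_xor d) (sym (xor-identityʳ b))

x∈p⇒p△[⁅x⁆∪⁅x⁆]≡p-x : x ∈ p → p △ (⁅ x ⁆ ∪ ⁅ x ⁆) ≡ p - x
x∈p⇒p△[⁅x⁆∪⁅x⁆]≡p-x {x = x} {p = p} x∈p = trans (cong (p △_) (∪-idem ⁅ x ⁆)) (x∈p⇒p△⁅x⁆≡p-x x∈p)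

x∈p∧y∉p⇒p△[⁅x⁆∪⁅y⁆]≡p-x∪⁅y⁆ : x ∈ p → y ∉ p → p △ (⁅ x ⁆ ∪ ⁅ y ⁆) ≡ (p - x) ∪ ⁅ y ⁆
x∈p∧y∉p⇒p△[⁅x⁆∪⁅y⁆]≡p-x∪⁅y⁆ {x = x} {p = p} {y = y} x∈p y∉p = begin
  p △ (⁅ x ⁆ ∪ ⁅ y ⁆)  ≡⟨ p△[q∪s]≡p△q△s disjoint ⟩
  p △ ⁅ x ⁆ △ ⁅ y ⁆    ≡⟨ cong (_△ ⁅ y ⁆) (x∈p⇒p△⁅x⁆≡p-x x∈p) ⟩
  (p - x) △ ⁅ y ⁆      ≡⟨ x∉p⇒p△⁅x⁆≡p∪⁅x⁆ (y∉p ∘ p─q⊆p p ⁅ x ⁆) ⟩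
  (p - x) ∪ ⁅ y ⁆      ∎
  where
  open ≡-Reasoning
  disjoint : ∀ {z} → z ∈ ⁅ x ⁆ → z ∉ ⁅ y ⁆
  disjoint z∈⁅x⁆ z∈⁅y⁆ with refl ← x∈⁅y⁆⇒x≡y x z∈⁅x⁆ | refl ← x∈⁅y⁆⇒x≡y y z∈⁅y⁆ = y∉p x∈p

p△[⁅x⁆∪⁅y⁆∪q]≡[p-x∪⁅y⁆]△q : x ∈ p → y ∉ p → x ∉ q → y ∉ q →
                             p △ (⁅ x ⁆ ∪ ⁅ y ⁆ ∪ q) ≡ ((p - x) ∪ ⁅ y ⁆) △ q
p△[⁅x⁆∪⁅y⁆∪q]≡[p-x∪⁅y⁆]△q {x = x} {p = p} {y = y} {q = q} x∈p y∉p x∉q y∉q = begin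
  p △ (⁅ x ⁆ ∪ ⁅ y ⁆ ∪ q)    ≡⟨ cong (p △_) (sym (∪-assoc ⁅ x ⁆ ⁅ y ⁆ q)) ⟩
  p △ ((⁅ x ⁆ ∪ ⁅ y ⁆) ∪ q)  ≡⟨ p△[q∪s]≡p△q△s disjoint ⟩
  p △ (⁅ x ⁆ ∪ ⁅ y ⁆) △ q    ≡⟨ cong (_△ q) (x∈p∧y∉p⇒p△[⁅x⁆∪⁅y⁆]≡p-x∪⁅y⁆ x∈p y∉p) ⟩
  ((p - x) ∪ ⁅ y ⁆) △ q      ∎
  where
  open ≡-Reasoning
  disjoint : ∀ {z} → z ∈ ⁅ x ⁆ ∪ ⁅ y ⁆ → z ∉ q
  disjoint z∈ with x∈p∪⁅y⁆⁻ z∈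
  ... | inj₂ refl = y∉q
  ... | inj₁ z∈⁅x⁆ with refl ← x∈⁅y⁆⇒x≡y x z∈⁅x⁆ = x∉q

module _ {n : ℕ} {r : Subset n → ℕ} {T : Subset n} (rank : IsMatroidRankOn r T) where
  open IsMatroidRankOn rank
  open import Data.Product using (_,_)
  open ≤-Reasoning

  -- the nullity ∣ X ∣ ∸ r X is monotone (stated without truncated subtraction)
  nullity-mono : ∀ {X Y} → X ⊆ Y → Y ⊆ T → r Y + ∣ X ∣ ≤ r X + ∣ Y ∣
  nullity-mono {X} {Y} X⊆Y Y⊆T = begin
    r Y + ∣ X ∣               ≤⟨ +-monoˡ-≤ ∣ X ∣ (monotone Y (X ∪ (Y ─ X)) X∪D⊆T Y⊆X∪D) ⟩
    r (X ∪ (Y ─ X)) + ∣ X ∣   ≤⟨ +-monoˡ-≤ ∣ X ∣ (≤-trans (m≤m+n _ _) (submod X (Y ─ X) X⊆T D⊆T)) ⟩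
    r X + r (Y ─ X) + ∣ X ∣   ≤⟨ +-monoˡ-≤ ∣ X ∣ (+-monoʳ-≤ (r X) (bounded (Y ─ X) D⊆T)) ⟩
    r X + ∣ Y ─ X ∣ + ∣ X ∣   ≡⟨ +-assoc (r X) ∣ Y ─ X ∣ ∣ X ∣ ⟩
    r X + (∣ Y ─ X ∣ + ∣ X ∣) ≡⟨ cong (r X +_) (+-comm ∣ Y ─ X ∣ ∣ X ∣) ⟩
    r X + (∣ X ∣ + ∣ Y ─ X ∣) ≡⟨ cong (r X +_) (p⊆q⇒∣q∣≡∣p∣+∣q─p∣ X⊆Y) ⟨
    r X + ∣ Y ∣               ∎
    where
    X⊆T : X ⊆ T
    X⊆T = Y⊆T ∘ X⊆Y
    D⊆T : Y ─ X ⊆ T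
    D⊆T = Y⊆T ∘ p─q⊆p Y X
    X∪D⊆T : X ∪ (Y ─ X) ⊆ T
    X∪D⊆T = p⊆s∧q⊆s⇒p∪q⊆s X⊆T D⊆T
    Y⊆X∪D : Y ⊆ X ∪ (Y ─ X)
    Y⊆X∪D {i} i∈Y with i ∈? X
    ... | yes i∈X = x∈p∪q⁺ (inj₁ i∈X)
    ... | no  i∉X = x∈p∪q⁺ (inj₂ (x∈p∧x∉q⇒x∈p─q i∈Y i∉X))

  r[C]≤r[C-f]⇒r[Y]≤r[Y-f] : ∀ {C Y f} → C ⊆ Y → Y ⊆ T → f ∈ C → r C ≤ r (C - f) → r Y ≤ r (Y - f)
  r[C]≤r[C-f]⇒r[Y]≤r[Y-f] {C} {Y} {f} C⊆Y Y⊆T f∈C r[C]≤r[C-f] =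
    +-cancelʳ-≤ (r (C - f)) (r Y) (r (Y - f)) (begin
    r Y + r (C - f)                    ≤⟨ +-mono-≤ (monotone Y _ ∪⊆T Y⊆∪) (monotone (C - f) _ ∩⊆T C-f⊆∩) ⟩
    r ((Y - f) ∪ C) + r ((Y - f) ∩ C)  ≤⟨ submod (Y - f) C Y-f⊆T C⊆T ⟩
    r (Y - f) + r C                    ≤⟨ +-monoʳ-≤ (r (Y - f)) r[C]≤r[C-f] ⟩
    r (Y - f) + r (C - f)              ∎)
    where
    C⊆T : C ⊆ T
    C⊆T = Y⊆T ∘ C⊆Y
    Y-f⊆T : Y - f ⊆ T
    Y-f⊆T = Y⊆T ∘ p─q⊆p Y ⁅ f ⁆
    ∪⊆T : (Y - f) ∪ C ⊆ T
    ∪⊆T = p⊆s∧q⊆s⇒p∪q⊆s Y-f⊆T C⊆T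
    ∩⊆T : (Y - f) ∩ C ⊆ T
    ∩⊆T = C⊆T ∘ p∩q⊆q (Y - f) C
    Y⊆∪ : Y ⊆ (Y - f) ∪ C
    Y⊆∪ {i} i∈Y with i ≟ f
    ... | yes refl = x∈p∪q⁺ (inj₂ f∈C)
    ... | no  i≢f  = x∈p∪q⁺ (inj₁ (x∈p∧x≢y⇒x∈p-y i∈Y i≢f))
    C-f⊆∩ : C - f ⊆ (Y - f) ∩ C
    C-f⊆∩ i∈C-f = let i∈C = p─q⊆p C ⁅ f ⁆ i∈C-f in
      x∈p∩q⁺ (x∈p∧x≢y⇒x∈p-y (C⊆Y i∈C) (x∈p-y⇒x≢y i∈C-f) , i∈C)

module _ {n m : ℕ} (Z : Multimatroid n m) where
  open Multimatroid Z
  open import Data.Product using (_,_)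

  Meets : Subset n → Fin m → Set
  Meets S c = ∃[ x ] (x ∈ S × cls x ≡ c)

  meets? : ∀ S c → Dec (Meets S c)
  meets? S c = any? λ x → x ∈? S ×-dec cls x ≟ c

  subtransversal-⊆ : ∀ {S S′} → S ⊆ S′ → IsSubtransversal cls S′ → IsSubtransversal cls S
  subtransversal-⊆ S⊆S′ st x∈S y∈S = st (S⊆S′ x∈S) (S⊆S′ y∈S)

  subtransversal-∪⁅⁆ : ∀ {S z} → IsSubtransversal cls S → DisjointFromClass cls S (cls z) →
                       IsSubtransversal cls (S ∪ ⁅ z ⁆)
  subtransversal-∪⁅⁆ st disjoint x∈ y∈ x∼y with x∈p∪⁅y⁆⁻ x∈ | x∈p∪⁅y⁆⁻ y∈
  ... | inj₁ x∈S  | inj₁ y∈S  = st x∈S y∈S x∼y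
  ... | inj₁ x∈S  | inj₂ refl = contradiction x∼y (disjoint x∈S)
  ... | inj₂ refl | inj₁ y∈S  = contradiction (sym x∼y) (disjoint y∈S)
  ... | inj₂ refl | inj₂ refl = refl

  subtransversal-minus-disjoint : ∀ {X a} → IsSubtransversal cls X → a ∈ X →
                                  DisjointFromClass cls (X - a) (cls a)
  subtransversal-minus-disjoint {X} {a} st a∈X z∈X-a z∼a =
    x∈p-y⇒x≢y z∈X-a (st (p─q⊆p X ⁅ a ⁆ z∈X-a) a∈X z∼a)

  subtransversal-minus-not-transversal : ∀ {X a} → IsSubtransversal cls X → a ∈ X →
                                         ¬ IsTransversal cls (X - a)
  subtransversal-minus-not-transversal {a = a} st a∈X (_ , meets) =
    let _ , z∈X-a , z∼a = meets (cls a) in subtransversal-minus-disjoint st a∈X z∈X-a z∼a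

  transversal-swap : ∀ {X a a′} → IsTransversal cls X → a ∈ X → cls a′ ≡ cls a →
                     IsTransversal cls ((X - a) ∪ ⁅ a′ ⁆)
  transversal-swap {X} {a} {a′} (st , meets) a∈X a′∼a = st′ , meets′
    where
    st′ : IsSubtransversal cls ((X - a) ∪ ⁅ a′ ⁆)
    st′ = subtransversal-∪⁅⁆ (subtransversal-⊆ (p─q⊆p X ⁅ a ⁆) st)
            (subst (DisjointFromClass cls (X - a)) (sym a′∼a) (subtransversal-minus-disjoint st a∈X))
    meets′ : ∀ c → Meets ((X - a) ∪ ⁅ a′ ⁆) c
    meets′ c with meets c
    ... | x , x∈X , x∈c with x ≟ a
    ...   | yes refl = a′ , x∈p∪q⁺ (inj₂ (x∈⁅x⁆ a′)) , trans a′∼a x∈c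
    ...   | no  x≢a  = x , x∈p∪q⁺ (inj₁ (x∈p∧x≢y⇒x∈p-y x∈X x≢a)) , x∈c

  representative : Fin m → Fin n
  representative c = proj₁ (nonempty c)

  completes : Subset n → Fin n → Set
  completes S i = i ∈ S ⊎ (¬ Meets S (cls i) × i ≡ representative (cls i))

  completes? : ∀ S → Decidable (completes S)
  completes? S i = i ∈? S ⊎-dec (¬? (meets? S (cls i)) ×-dec i ≟ representative (cls i))

  completion : Subset n → Subset n
  completion S = tabulate (does ∘ completes? S)

  ⊆-completion : ∀ {S} → S ⊆ completion S
  ⊆-completion {S} x∈S = ∈-tabulate-does⁺ (completes? S) (inj₁ x∈S)

  completion-transversal : ∀ {S} → IsSubtransversal cls S → IsTransversal cls (completion S)
  completion-transversal {S} st = st′ , meets′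
    where
    st′ : IsSubtransversal cls (completion S)
    st′ x∈ y∈ x∼y with ∈-tabulate-does⁻ (completes? S) x∈ | ∈-tabulate-does⁻ (completes? S) y∈
    ... | inj₁ x∈S | inj₁ y∈S = st x∈S y∈S x∼y
    ... | inj₁ x∈S | inj₂ (y-misses , _) = contradiction (_ , x∈S , x∼y) y-misses
    ... | inj₂ (x-misses , _) | inj₁ y∈S = contradiction (_ , y∈S , sym x∼y) x-misses
    ... | inj₂ (_ , x≡rep) | inj₂ (_ , y≡rep) = trans x≡rep (trans (cong representative x∼y) (sym y≡rep))
    meets′ : ∀ c → Meets (completion S) c
    meets′ c with meets? S c
    ... | yes (x , x∈S , x∈c) = x , ⊆-completion x∈S , x∈c
    ... | no  misses =
      representative c , ∈-tabulate-does⁺ (completes? S) (inj₂ (misses′ , cong representative (sym rep∈c))) , rep∈c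
      where
      rep∈c : cls (representative c) ≡ c
      rep∈c = proj₂ (nonempty c)
      misses′ : ¬ Meets S (cls (representative c))
      misses′ = subst (¬_ ∘ Meets S) (sym rep∈c) misses

  r-bounded : ∀ {S} → IsSubtransversal cls S → r S ≤ ∣ S ∣
  r-bounded {S} st = IsMatroidRankOn.bounded (R1 _ (completion-transversal st)) S ⊆-completion

  independent-⊆ : ∀ {S X} → IsIndependent Z S → X ⊆ S → IsIndependent Z X
  independent-⊆ {S} {X} (st , r[S]≡∣S∣) X⊆S = st′ , ≤-antisym (r-bounded st′) ∣X∣≤r[X]
    where
    open ≤-Reasoning
    st′ : IsSubtransversal cls X
    st′ = subtransversal-⊆ X⊆S st
    ∣X∣≤r[X] : ∣ X ∣ ≤ r X
    ∣X∣≤r[X] = +-cancelˡ-≤ ∣ S ∣ ∣ X ∣ (r X) (begin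
      ∣ S ∣ + ∣ X ∣ ≡⟨ cong (_+ ∣ X ∣) r[S]≡∣S∣ ⟨
      r S + ∣ X ∣   ≤⟨ nullity-mono (R1 _ (completion-transversal st)) X⊆S ⊆-completion ⟩
      r X + ∣ S ∣   ≡⟨ +-comm (r X) ∣ S ∣ ⟩
      ∣ S ∣ + r X   ∎)

  transversal⇒basis : ∀ {X} → IsTransversal cls X → r X ≡ ∣ X ∣ → IsBasis Z X
  transversal⇒basis {X} (st , meets) r[X]≡∣X∣ = (st , r[X]≡∣X∣) , maximal
    where
    maximal : ∀ S → X ⊆ S → IsIndependent Z S → S ≡ X
    maximal S X⊆S (stS , _) = ⊆-antisym S⊆X X⊆S
      where
      S⊆X : S ⊆ X
      S⊆X {i} i∈S = let j , j∈X , j∼i = meets (cls i) in subst (_∈ X) (stS (X⊆S j∈X) i∈S j∼i) j∈X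

  basis⇒r[B∪⁅z⁆]≤r[B] : ∀ {B z} → IsBasis Z B → IsSubtransversal cls (B ∪ ⁅ z ⁆) → z ∉ B →
                        r (B ∪ ⁅ z ⁆) ≤ r B
  basis⇒r[B∪⁅z⁆]≤r[B] {B} {z} ((_ , r[B]≡∣B∣) , maximal) st z∉B =
    subst (r (B ∪ ⁅ z ⁆) ≤_) (sym r[B]≡∣B∣) (s≤s⁻¹ (≤∧≢⇒< r≤suc∣B∣ r≢suc∣B∣))
    where
    ∣B∪⁅z⁆∣≡suc∣B∣ : ∣ B ∪ ⁅ z ⁆ ∣ ≡ suc ∣ B ∣
    ∣B∪⁅z⁆∣≡suc∣B∣ = x∉p⇒∣p∪⁅x⁆∣≡suc∣p∣ z∉B
    r≤suc∣B∣ : r (B ∪ ⁅ z ⁆) ≤ suc ∣ B ∣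
    r≤suc∣B∣ = subst (r (B ∪ ⁅ z ⁆) ≤_) ∣B∪⁅z⁆∣≡suc∣B∣ (r-bounded st)
    r≢suc∣B∣ : r (B ∪ ⁅ z ⁆) ≢ suc ∣ B ∣
    r≢suc∣B∣ r≡suc∣B∣ = z∉B (subst (z ∈_) (maximal _ (p⊆p∪q ⁅ z ⁆) (st , trans r≡suc∣B∣ (sym ∣B∪⁅z⁆∣≡suc∣B∣)))
                                         (x∈p∪q⁺ (inj₂ (x∈⁅x⁆ z))))

  r[S∪⁅x⁆]≤r[S]⇒r[S]<r[S∪⁅y⁆] : ∀ {S x y} → IsSubtransversal cls S → x ≢ y → cls x ≡ cls y →
                                DisjointFromClass cls S (cls x) → r (S ∪ ⁅ x ⁆) ≤ r S → r S < r (S ∪ ⁅ y ⁆)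
  r[S∪⁅x⁆]≤r[S]⇒r[S]<r[S∪⁅y⁆] {S} {x} {y} st x≢y x∼y disjoint r[S∪⁅x⁆]≤r[S] =
    +-cancelˡ-≤ (r S) (suc (r S)) (r (S ∪ ⁅ y ⁆)) (begin
      r S + suc (r S)                ≡⟨ +-suc (r S) (r S) ⟩
      suc (r S + r S)                ≡⟨ cong (λ k → suc (r S + k)) (+-identityʳ (r S)) ⟨
      1 + 2 * r S                    ≤⟨ R2 S x y st x≢y x∼y disjoint ⟩
      r (S ∪ ⁅ x ⁆) + r (S ∪ ⁅ y ⁆)  ≤⟨ +-monoˡ-≤ (r (S ∪ ⁅ y ⁆)) r[S∪⁅x⁆]≤r[S] ⟩
      r S + r (S ∪ ⁅ y ⁆)            ∎)
    where open ≤-Reasoning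

  basis⇒transversal : NonDegenerate Z → ∀ {B} → IsBasis Z B → IsTransversal cls B
  basis⇒transversal nd {B} basis = st , meets
    where
    st : IsSubtransversal cls B
    st = proj₁ (proj₁ basis)
    meets : ∀ c → Meets B c
    meets c with meets? B c
    ... | yes B-meets = B-meets
    ... | no  misses with nd c
    ...   | x , y , x≢y , x∈c , y∈c =
      ⊥-elim (<⇒≱ (r[S∪⁅x⁆]≤r[S]⇒r[S]<r[S∪⁅y⁆] st x≢y (trans x∈c (sym y∈c)) (disjoint x∈c) (no-gain x∈c))
                  (no-gain y∈c))
      where
      disjoint : ∀ {z} → cls z ≡ c → DisjointFromClass cls B (cls z)
      disjoint z∈c w∈B w∼z = misses (_ , w∈B , trans w∼z z∈c)
      no-gain : ∀ {z} → cls z ≡ c → r (B ∪ ⁅ z ⁆) ≤ r B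
      no-gain z∈c =
        basis⇒r[B∪⁅z⁆]≤r[B] basis (subtransversal-∪⁅⁆ st (disjoint z∈c)) (λ z∈B → disjoint z∈c z∈B refl)

  skew-partner : NonDegenerate Z → ∀ f → ∃[ x ] (cls x ≡ cls f × x ≢ f)
  skew-partner nd f with nd (cls f)
  ... | x , y , x≢y , x∼f , y∼f with x ≟ f
  ...   | yes refl = y , y∼f , x≢y ∘ sym
  ...   | no  x≢f  = x , x∼f , x≢f

  circuit⇒r[C]≤r[C-f] : ∀ {C f} → IsCircuit Z C → f ∈ C → r C ≤ r (C - f)
  circuit⇒r[C]≤r[C-f] {C} {f} (_ , r[C]<∣C∣ , minimal) f∈C =
    ≤-trans (s≤s⁻¹ (subst (r C <_) (sym (x∈p⇒suc∣p-x∣≡∣p∣ f∈C)) r[C]<∣C∣)) (≮⇒≥ C-f-independent)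
    where
    C-f-independent : ¬ (r (C - f) < ∣ C - f ∣)
    C-f-independent dependent = x∉p-x C f (subst (f ∈_) (sym (minimal (C - f) (p─q⊆p C ⁅ f ⁆) dependent)) f∈C)

  independent⇒nullity[X∪⁅u⁆]≤1 : ∀ {X u} → IsIndependent Z X → u ∉ X → IsTransversal cls (X ∪ ⁅ u ⁆) →
                                      ∣ X ∪ ⁅ u ⁆ ∣ ≤ suc (r (X ∪ ⁅ u ⁆))
  independent⇒nullity[X∪⁅u⁆]≤1 {X} {u} (_ , r[X]≡∣X∣) u∉X tr = begin
    ∣ X ∪ ⁅ u ⁆ ∣        ≡⟨ x∉p⇒∣p∪⁅x⁆∣≡suc∣p∣ u∉X ⟩
    suc ∣ X ∣            ≡⟨ cong suc r[X]≡∣X∣ ⟨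
    suc (r X)            ≤⟨ s≤s (IsMatroidRankOn.monotone (R1 _ tr) X (X ∪ ⁅ u ⁆) ⊆-refl (p⊆p∪q ⁅ u ⁆)) ⟩
    suc (r (X ∪ ⁅ u ⁆))  ∎
    where open ≤-Reasoning

  exchange-basis : ∀ {T C f x} → IsTransversal cls T → ∣ T ∣ ≤ suc (r T) → IsCircuit Z C → C ⊆ T → f ∈ C →
                   cls x ≡ cls f → x ≢ f → IsBasis Z ((T - f) ∪ ⁅ x ⁆)
  exchange-basis {T} {C} {f} {x} T-tr@(T-st , _) nullity≤1 circuit C⊆T f∈C x∼f x≢f =
    transversal⇒basis B′-tr (≤-antisym (r-bounded (proj₁ B′-tr)) (begin
      ∣ (T - f) ∪ ⁅ x ⁆ ∣  ≡⟨ x∉p⇒∣p∪⁅x⁆∣≡suc∣p∣ x∉T-f ⟩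
      suc ∣ T - f ∣        ≤⟨ s≤s ∣T-f∣≤r[T-f] ⟩
      suc (r (T - f))      ≤⟨ r[T-f]<r[B′] ⟩
      r ((T - f) ∪ ⁅ x ⁆)  ∎))
    where
    open ≤-Reasoning
    open IsMatroidRankOn (R1 T T-tr) using (monotone)
    f∈T : f ∈ T
    f∈T = C⊆T f∈C
    T-f⊆T : T - f ⊆ T
    T-f⊆T = p─q⊆p T ⁅ f ⁆
    B′-tr : IsTransversal cls ((T - f) ∪ ⁅ x ⁆)
    B′-tr = transversal-swap T-tr f∈T x∼f
    disjoint : DisjointFromClass cls (T - f) (cls f)
    disjoint = subtransversal-minus-disjoint T-st f∈T
    x∉T-f : x ∉ T - f
    x∉T-f x∈T-f = disjoint x∈T-f x∼f
    r[T]≤r[T-f] : r T ≤ r (T - f)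
    r[T]≤r[T-f] = r[C]≤r[C-f]⇒r[Y]≤r[Y-f] (R1 T T-tr) C⊆T ⊆-refl f∈C (circuit⇒r[C]≤r[C-f] circuit f∈C)
    ∣T-f∣≤r[T-f] : ∣ T - f ∣ ≤ r (T - f)
    ∣T-f∣≤r[T-f] = ≤-trans (s≤s⁻¹ (subst (_≤ suc (r T)) (sym (x∈p⇒suc∣p-x∣≡∣p∣ f∈T)) nullity≤1)) r[T]≤r[T-f]
    r[T-f]<r[B′] : r (T - f) < r ((T - f) ∪ ⁅ x ⁆)
    r[T-f]<r[B′] = r[S∪⁅x⁆]≤r[S]⇒r[S]<r[S∪⁅y⁆] (subtransversal-⊆ T-f⊆T T-st) (x≢f ∘ sym) (sym x∼f) disjoint
      (≤-trans (monotone ((T - f) ∪ ⁅ f ⁆) T ⊆-refl (p⊆s∧q⊆s⇒p∪q⊆s T-f⊆T (x∈p⇒⁅x⁆⊆p f∈T))) r[T]≤r[T-f])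

  ∈circuit⇔exchangeable : NonDegenerate Z → ∀ {T C f} → IsTransversal cls T → ∣ T ∣ ≤ suc (r T) →
                          IsCircuit Z C → C ⊆ T → f ∈ T →
                          f ∈ C ⇔ (∃[ x ] (cls x ≡ cls f × IsBasis Z (T △ (⁅ f ⁆ ∪ ⁅ x ⁆))))
  ∈circuit⇔exchangeable nd {T} {C} {f} T-tr@(T-st , _) nullity≤1 circuit@(_ , r[C]<∣C∣ , _) C⊆T f∈T =
    mk⇔ to from
    where
    T△≡ : ∀ {x} → cls x ≡ cls f → x ≢ f → T △ (⁅ f ⁆ ∪ ⁅ x ⁆) ≡ (T - f) ∪ ⁅ x ⁆
    T△≡ x∼f x≢f = x∈p∧y∉p⇒p△[⁅x⁆∪⁅y⁆]≡p-x∪⁅y⁆ f∈T (λ x∈T → x≢f (T-st x∈T f∈T x∼f))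

    to : f ∈ C → ∃[ x ] (cls x ≡ cls f × IsBasis Z (T △ (⁅ f ⁆ ∪ ⁅ x ⁆)))
    to f∈C = let x , x∼f , x≢f = skew-partner nd f in
      x , x∼f , subst (IsBasis Z) (sym (T△≡ x∼f x≢f)) (exchange-basis T-tr nullity≤1 circuit C⊆T f∈C x∼f x≢f)

    from : ∃[ x ] (cls x ≡ cls f × IsBasis Z (T △ (⁅ f ⁆ ∪ ⁅ x ⁆))) → f ∈ C
    from (x , x∼f , basis) with f ∈? C | x ≟ f
    ... | yes f∈C | _        = f∈C
    ... | no  f∉C | yes refl = ⊥-elim (subtransversal-minus-not-transversal T-st f∈T
                                 (basis⇒transversal nd (subst (IsBasis Z) (x∈p⇒p△[⁅x⁆∪⁅x⁆]≡p-x f∈T) basis)))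
    ... | no  f∉C | no  x≢f  = ⊥-elim (<⇒≢ r[C]<∣C∣ (proj₂ (independent-⊆ (proj₁ B′-basis) C⊆B′)))
      where
      B′-basis : IsBasis Z ((T - f) ∪ ⁅ x ⁆)
      B′-basis = subst (IsBasis Z) (T△≡ x∼f x≢f) basis
      C⊆B′ : C ⊆ (T - f) ∪ ⁅ x ⁆
      C⊆B′ i∈C = x∈p∪q⁺ (inj₁ (x∈p∧x≢y⇒x∈p-y (C⊆T i∈C) λ { refl → f∉C i∈C }))

  fundamental-circuit⊆swap : ∀ {B ω C b u} → IsFundamentalCircuit Z B ω C → u ∈ C → cls u ≡ ω → cls b ≡ ω →
                             C ⊆ (B - b) ∪ ⁅ u ⁆
  fundamental-circuit⊆swap {ω = ω} ((C-st , _) , C⊆B∪ω) u∈C u∈ω b∈ω {i} i∈C with cls i ≟ ω | C⊆B∪ω i i∈C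
  ... | yes i∈ω | _        with refl ← C-st i∈C u∈C (trans i∈ω (sym u∈ω)) = x∈p∪q⁺ (inj₂ (x∈⁅x⁆ i))
  ... | no  i∉ω | inj₁ i∈B = x∈p∪q⁺ (inj₁ (x∈p∧x≢y⇒x∈p-y i∈B λ { refl → i∉ω b∈ω }))
  ... | no  i∉ω | inj₂ i∈ω = contradiction i∈ω i∉ω

lemma2p3 : ∀ {n m : ℕ} (Z : Multimatroid n m) → NonDegenerate Z →
           ∀ (B : Subset n) (ω : Fin m) (C : Subset n) →
           IsBasis Z B → IsFundamentalCircuit Z B ω C →
           ∀ (b : Fin n) → b ∈ B → Multimatroid.cls Z b ≡ ω →
           ∀ (u : Fin n) → u ∈ C → u ∉ B →
           ∀ (f : Fin n) → f ∈ B → Multimatroid.cls Z f ≢ ω →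
           (f ∈ C ⇔ (∃[ x ] (Multimatroid.cls Z x ≡ Multimatroid.cls Z f ×
                              IsBasis Z (B △ ⁅ b , u , f , x ⁆))))
lemma2p3 Z nd B ω C basis fundamental b b∈B b∈ω u u∈C u∉B f f∈B f∉ω =
  mk⇔ (λ f∈C → let x , x∼f , exchanged = to f∈C in x , x∼f , subst (IsBasis Z) (sym (B△≡T△ x∼f)) exchanged)
      (λ (x , x∼f , exchanged) → from (x , x∼f , subst (IsBasis Z) (B△≡T△ x∼f) exchanged))
  where
  open Multimatroid Z
  open import Data.Product using (_,_)
  u∈ω : cls u ≡ ω
  u∈ω = [ (λ u∈B → contradiction u∈B u∉B) , id ]′ (proj₂ fundamental u u∈C)
  T-tr : IsTransversal cls ((B - b) ∪ ⁅ u ⁆)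
  T-tr = transversal-swap Z (basis⇒transversal Z nd basis) b∈B (trans u∈ω (sym b∈ω))
  nullity≤1 : ∣ (B - b) ∪ ⁅ u ⁆ ∣ ≤ suc (r ((B - b) ∪ ⁅ u ⁆))
  nullity≤1 = independent⇒nullity[X∪⁅u⁆]≤1 Z (independent-⊆ Z (proj₁ basis) (p─q⊆p B ⁅ b ⁆))
                                                (u∉B ∘ p─q⊆p B ⁅ b ⁆) T-tr
  f∈T : f ∈ (B - b) ∪ ⁅ u ⁆
  f∈T = x∈p∪q⁺ (inj₁ (x∈p∧x≢y⇒x∈p-y f∈B λ { refl → f∉ω b∈ω }))
  open Equivalence (∈circuit⇔exchangeable Z nd T-tr nullity≤1 (proj₁ fundamental)
                     (fundamental-circuit⊆swap Z fundamental u∈C u∈ω b∈ω) f∈T)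
  B△≡T△ : ∀ {x} → cls x ≡ cls f → B △ (⁅ b ⁆ ∪ ⁅ u ⁆ ∪ ⁅ f ⁆ ∪ ⁅ x ⁆) ≡ ((B - b) ∪ ⁅ u ⁆) △ (⁅ f ⁆ ∪ ⁅ x ⁆)
  B△≡T△ {x} x∼f = p△[⁅x⁆∪⁅y⁆∪q]≡[p-x∪⁅y⁆]△q b∈B u∉B (∉⁅f⁆∪⁅x⁆ b∈ω) (∉⁅f⁆∪⁅x⁆ u∈ω)
    where
    ∉⁅f⁆∪⁅x⁆ : ∀ {y} → cls y ≡ ω → y ∉ ⁅ f ⁆ ∪ ⁅ x ⁆
    ∉⁅f⁆∪⁅x⁆ y∈ω = x∉p∧x∉q⇒x∉p∪q (x≢y⇒x∉⁅y⁆ λ { refl → f∉ω y∈ω })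
                                  (x≢y⇒x∉⁅y⁆ λ { refl → f∉ω (trans (sym x∼f) y∈ω) })
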